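{- Let $n\ge 2$ be an integer and let $A,B,C,D$ be the blocks defined in the context (each in its defined location). Then the blocks $A,B,C,D$ are pairwise equivalent under compositions of rotations and translations of $\mathbb{R}^4$; that is, for any two of these blocks there is a composition of rotations and translations of $\mathbb{R}^4$ mapping the first block onto the second.
   Context: Coordinates on $\mathbb{R}^4$ are $(x,y,z,w)$. For integers $a,b,c,d$, the unit cube with location label $(a,b,c,d)$ is the set $\{(x,y,z,w): a-1\le x\le a,\ b-1\le y\le b,\ c-1\le z\le c,\ d-1\le w\le d\}$. A block is a union of unit cubes, described by its set of location labels. For a fixed integer $n\ge 2$, the blocks (in their defined locations) are the unions of the unit cubes with labels in the following sets: $A=\{(x,y,z,w): 1\le i\le n,\ z=i,\ x,y,w\in\{1,\dots,i\}\}$; $B=\{(x,y,z,w): 1\le i\le n,\ y=i+1,\ x,z,w\in\{1,\dots,i\}\}$; $C=\{(x,y,z,w): 1\le i\le n,\ x=i+1,\ y\in\{2,\dots,i+1\},\ z,w\in\{1,\dots,i\}\}$; $D=\{(x,y,z,w): 1\le i\le n,\ w=i,\ x,y\in\{1,\dots,i\},\ z\in\{0,\dots,i-1\}\}$. Each block consists of $1^3+2^3+\cdots+n^3$ unit cubes. -}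

module Defs where

open import Data.Nat using (ℕ; suc)
import Data.Nat as N
open import Data.Integer using (ℤ; +_; _+_; _-_; -_; _≤_)
open import Data.Product using (Σ; _×_; _,_)
open import Data.List using (List; []; _∷_)
open import Relation.Binary.PropositionalEquality using (_≡_)

-- A location label (a,b,c,d) ∈ ℤ⁴ of the unit cube
-- [a-1,a]×[b-1,b]×[c-1,c]×[d-1,d].
Lab : Set
Lab = ℤ × ℤ × ℤ × ℤ

_∈[_,_] : ℤ → ℤ → ℤ → Set
v ∈[ lo , hi ] = lo ≤ v × v ≤ hi

data Blk : Set where
  bA bB bC bD : Blk

block : ℕ → Blk → Lab → Set
block n bA (x , y , z , w) =
  Σ ℕ λ i → 1 N.≤ i × i N.≤ n × z ≡ + i
    × x ∈[ + 1 , + i ] × y ∈[ + 1 , + i ] × w ∈[ + 1 , + i ]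
block n bB (x , y , z , w) =
  Σ ℕ λ i → 1 N.≤ i × i N.≤ n × y ≡ + suc i
    × x ∈[ + 1 , + i ] × z ∈[ + 1 , + i ] × w ∈[ + 1 , + i ]
block n bC (x , y , z , w) =
  Σ ℕ λ i → 1 N.≤ i × i N.≤ n × x ≡ + suc i
    × y ∈[ + 2 , + suc i ] × z ∈[ + 1 , + i ] × w ∈[ + 1 , + i ]
block n bD (x , y , z , w) =
  Σ ℕ λ i → 1 N.≤ i × i N.≤ n × w ≡ + i
    × x ∈[ + 1 , + i ] × y ∈[ + 1 , + i ] × z ∈[ + 0 , + i - + 1 ]

-- Elementary rigid motions of ℝ⁴ preserving the unit-cube lattice:
-- a quarter-turn rotation in one of the six coordinate planes (e_i,e_j), i<j,
-- namely (x_i , x_j) ↦ (-x_j , x_i), and a translation by an integer vector.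
data Plane : Set where
  pxy pxz pxw pyz pyw pzw : Plane

data Step : Set where
  rot   : Plane → Step
  trans : Lab → Step

-- The point map x_i ↦ -x_j sends the interval
-- [a_j - 1, a_j] to [-a_j, -a_j + 1], i.e. to label 1 - a_j; the map
-- x_j ↦ x_i keeps label a_i; translation by t adds t to the label.
rotLab : Plane → Lab → Lab
rotLab pxy (x , y , z , w) = (+ 1 - y , x , z , w)
rotLab pxz (x , y , z , w) = (+ 1 - z , y , x , w)
rotLab pxw (x , y , z , w) = (+ 1 - w , y , z , x)
rotLab pyz (x , y , z , w) = (x , + 1 - z , y , w)
rotLab pyw (x , y , z , w) = (x , + 1 - w , z , y)
rotLab pzw (x , y , z , w) = (x , y , + 1 - w , z)

stepLab : Step → Lab → Lab
stepLab (rot p) l = rotLab p l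
stepLab (trans (a , b , c , d)) (x , y , z , w) = (x + a , y + b , z + c , w + d)

Motion : Set
Motion = List Step

apply : Motion → Lab → Lab
apply [] l = l
apply (s ∷ m) l = apply m (stepLab s l)

MapsOnto : Motion → (Lab → Set) → (Lab → Set) → Set
MapsOnto m P Q = (l : Lab) → (Q l → Σ Lab λ l' → P l' × apply m l' ≡ l)
                            × ((Σ Lab λ l' → P l' × apply m l' ≡ l) → Q l)

-- Each of B, C, D is the image of A under an explicit motion: an even permutation of the
-- coordinates, built from quarter-turns, followed by a translation, which maps the layer
-- of A with parameter i onto the layer of the other block with the same i.  Motions are
-- invertible because a quarter-turn has order four, so being congruent by a motion is
-- symmetric and transitive, and any two blocks are congruent through A.
module Submission where

open import Defs
open import Data.Nat using (ℕ; _≤_)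
open import Data.Integer using (ℤ; +_; _+_; _-_; -_)
open import Data.Integer.Properties using (+-identityʳ; +-comm; +-monoʳ-≤; +-monoˡ-≤)
open import Data.Integer.Tactic.RingSolver using (solve-∀)
open import Data.Product using (Σ; _×_; _,_; proj₁; proj₂)
open import Data.List using ([]; _∷_; _++_)
open import Relation.Binary.PropositionalEquality
  using (_≡_; refl; sym; cong; subst; _≗_; module ≡-Reasoning)
  renaming (trans to ≡-trans)

1-[1-v]≡v : ∀ v → + 1 - (+ 1 - v) ≡ v
1-[1-v]≡v = solve-∀

1-[1-v]+0≡v : ∀ v → + 1 - (+ 1 - v) + + 0 ≡ v
1-[1-v]+0≡v = solve-∀

1-[1-v]+1≡1+v : ∀ v → + 1 - (+ 1 - v) + + 1 ≡ + 1 + v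
1-[1-v]+1≡1+v = solve-∀

1+[v-1]≡v : ∀ v → + 1 + (v - + 1) ≡ v
1+[v-1]≡v = solve-∀

[1+v]-1≡v : ∀ v → + 1 + v - + 1 ≡ v
[1+v]-1≡v = solve-∀

v+k-k≡v : ∀ v k → v + k - k ≡ v
v+k-k≡v = solve-∀

Lab-≡ : ∀ {x y z w x′ y′ z′ w′ : ℤ} →
        x ≡ x′ → y ≡ y′ → z ≡ z′ → w ≡ w′ → _≡_ {A = Lab} (x , y , z , w) (x′ , y′ , z′ , w′)
Lab-≡ refl refl refl refl = refl

+-monoʳ-∈[] : ∀ k {v lo hi} → v ∈[ lo , hi ] → (k + v) ∈[ k + lo , k + hi ]
+-monoʳ-∈[] k (lo≤v , v≤hi) = +-monoʳ-≤ k lo≤v , +-monoʳ-≤ k v≤hi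

+-monoˡ-∈[] : ∀ k {v lo hi} → v ∈[ lo , hi ] → (v + k) ∈[ lo + k , hi + k ]
+-monoˡ-∈[] k (lo≤v , v≤hi) = +-monoˡ-≤ k lo≤v , +-monoˡ-≤ k v≤hi

apply-++ : ∀ m m′ l → apply (m ++ m′) l ≡ apply m′ (apply m l)
apply-++ []      m′ l = refl
apply-++ (s ∷ m) m′ l = apply-++ m m′ (stepLab s l)

rotLab⁴≡id : ∀ p l → rotLab p (rotLab p (rotLab p (rotLab p l))) ≡ l
rotLab⁴≡id pxy (x , y , z , w) = Lab-≡ (1-[1-v]≡v x) (1-[1-v]≡v y) refl refl
rotLab⁴≡id pxz (x , y , z , w) = Lab-≡ (1-[1-v]≡v x) refl (1-[1-v]≡v z) refl
rotLab⁴≡id pxw (x , y , z , w) = Lab-≡ (1-[1-v]≡v x) refl refl (1-[1-v]≡v w)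
rotLab⁴≡id pyz (x , y , z , w) = Lab-≡ refl (1-[1-v]≡v y) (1-[1-v]≡v z) refl
rotLab⁴≡id pyw (x , y , z , w) = Lab-≡ refl (1-[1-v]≡v y) refl (1-[1-v]≡v w)
rotLab⁴≡id pzw (x , y , z , w) = Lab-≡ refl refl (1-[1-v]≡v z) (1-[1-v]≡v w)

invertStep : Step → Motion
invertStep (rot p)                 = rot p ∷ rot p ∷ rot p ∷ []
invertStep (trans (a , b , c , d)) = trans (- a , - b , - c , - d) ∷ []

invertStep-inverseˡ : ∀ s l → apply (invertStep s) (stepLab s l) ≡ l
invertStep-inverseˡ (rot p) l = rotLab⁴≡id p l
invertStep-inverseˡ (trans (a , b , c , d)) (x , y , z , w) =
  Lab-≡ (v+k-k≡v x a) (v+k-k≡v y b) (v+k-k≡v z c) (v+k-k≡v w d)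

invert : Motion → Motion
invert []      = []
invert (s ∷ m) = invert m ++ invertStep s

invert-inverseˡ : ∀ m l → apply (invert m) (apply m l) ≡ l
invert-inverseˡ []      l = refl
invert-inverseˡ (s ∷ m) l = begin
  apply (invert m ++ invertStep s) (apply m (stepLab s l))        ≡⟨ apply-++ (invert m) (invertStep s) _ ⟩
  apply (invertStep s) (apply (invert m) (apply m (stepLab s l))) ≡⟨ cong (apply (invertStep s)) (invert-inverseˡ m _) ⟩
  apply (invertStep s) (stepLab s l)                              ≡⟨ invertStep-inverseˡ s l ⟩
  l                                                               ∎
  where open ≡-Reasoning

mapsOnto-intro : ∀ m {P Q} (f h : Lab → Lab) → apply m ≗ f → (∀ l → f (h l) ≡ l) →
                 (∀ {l} → P l → Q (f l)) → (∀ {l} → Q l → P (h l)) → MapsOnto m P Q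
mapsOnto-intro m {Q = Q} f h apply≗f f∘h≗id P⇒Q Q⇒P l =
  (λ q → h l , Q⇒P q , ≡-trans (apply≗f (h l)) (f∘h≗id l)) ,
  λ { (l′ , p , refl) → subst Q (sym (apply≗f l′)) (P⇒Q p) }

infix 4 _≅_

_≅_ : (Lab → Set) → (Lab → Set) → Set
P ≅ Q = Σ Motion λ m → MapsOnto m P Q

≅-sym : ∀ {P Q} → P ≅ Q → Q ≅ P
≅-sym {P} {Q} (m , m:P↠Q) =
  invert m ,
  mapsOnto-intro (invert m) (apply (invert m)) (apply m) (λ _ → refl) (invert-inverseˡ m) Q⇒P P⇒Q
  where
  P⇒Q : ∀ {l} → P l → Q (apply m l)
  P⇒Q {l} p = proj₂ (m:P↠Q (apply m l)) (l , p , refl)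

  Q⇒P : ∀ {l} → Q l → P (apply (invert m) l)
  Q⇒P {l} q with proj₁ (m:P↠Q l) q
  ... | l′ , p , refl = subst P (sym (invert-inverseˡ m l′)) p

≅-trans : ∀ {P Q R} → P ≅ Q → Q ≅ R → P ≅ R
≅-trans {P} {R = R} (m , m:P↠Q) (m′ , m′:Q↠R) = m ++ m′ , λ l → R⇒image l , image⇒R l
  where
  R⇒image : ∀ l → R l → Σ Lab λ l″ → P l″ × apply (m ++ m′) l″ ≡ l
  R⇒image l r with proj₁ (m′:Q↠R l) r
  ... | l′ , q , refl with proj₁ (m:P↠Q l′) q
  ... | l″ , p , refl = l″ , p , apply-++ m m′ l″

  image⇒R : ∀ l → (Σ Lab λ l″ → P l″ × apply (m ++ m′) l″ ≡ l) → R l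
  image⇒R _ (l″ , p , refl) =
    subst R (sym (apply-++ m m′ l″))
      (proj₂ (m′:Q↠R _) (apply m l″ , proj₂ (m:P↠Q _) (l″ , p , refl) , refl))

fromA : Blk → Motion
fromA bA = []
fromA bB = rot pyw ∷ rot pyz ∷ rot pyz ∷ rot pyz ∷ trans (+ 0 , + 1 , + 0 , + 0) ∷ []
fromA bC = rot pyz ∷ rot pxy ∷ trans (+ 1 , + 1 , + 0 , + 0) ∷ []
fromA bD = rot pzw ∷ rot pyz ∷ trans (+ 0 , + 0 , - + 1 , + 0) ∷ []

fromA-map : Blk → Lab → Lab
fromA-map bA l               = l
fromA-map bB (x , y , z , w) = (x , + 1 + z , w , y)
fromA-map bC (x , y , z , w) = (+ 1 + z , + 1 + x , y , w)
fromA-map bD (x , y , z , w) = (x , w , y - + 1 , z)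

toA-map : Blk → Lab → Lab
toA-map bA l               = l
toA-map bB (x , y , z , w) = (x , w , y - + 1 , z)
toA-map bC (x , y , z , w) = (y - + 1 , z , x - + 1 , w)
toA-map bD (x , y , z , w) = (x , + 1 + z , w , y)

apply-fromA : ∀ X → apply (fromA X) ≗ fromA-map X
apply-fromA bA l = refl
apply-fromA bB (x , y , z , w) =
  Lab-≡ (+-identityʳ x) (1-[1-v]+1≡1+v z) (1-[1-v]+0≡v w) (+-identityʳ y)
apply-fromA bC (x , y , z , w) =
  Lab-≡ (1-[1-v]+1≡1+v z) (+-comm x (+ 1)) (+-identityʳ y) (+-identityʳ w)
apply-fromA bD (x , y , z , w) =
  Lab-≡ (+-identityʳ x) (1-[1-v]+0≡v w) refl (+-identityʳ z)

fromA-map∘toA-map≗id : ∀ X l → fromA-map X (toA-map X l) ≡ l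
fromA-map∘toA-map≗id bA l = refl
fromA-map∘toA-map≗id bB (x , y , z , w) = Lab-≡ refl (1+[v-1]≡v y) refl refl
fromA-map∘toA-map≗id bC (x , y , z , w) = Lab-≡ (1+[v-1]≡v x) (1+[v-1]≡v y) refl refl
fromA-map∘toA-map≗id bD (x , y , z , w) = Lab-≡ refl refl ([1+v]-1≡v z) refl

fromA-map-preserves : ∀ n X {l} → block n bA l → block n X (fromA-map X l)
fromA-map-preserves n bA a = a
fromA-map-preserves n bB (i , 1≤i , i≤n , z≡i , x∈ , y∈ , w∈) =
  i , 1≤i , i≤n , cong (_+_ (+ 1)) z≡i , x∈ , w∈ , y∈
fromA-map-preserves n bC (i , 1≤i , i≤n , z≡i , x∈ , y∈ , w∈) =
  i , 1≤i , i≤n , cong (_+_ (+ 1)) z≡i , +-monoʳ-∈[] (+ 1) x∈ , y∈ , w∈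
fromA-map-preserves n bD (i , 1≤i , i≤n , z≡i , x∈ , y∈ , w∈) =
  i , 1≤i , i≤n , z≡i , x∈ , w∈ , +-monoˡ-∈[] (- + 1) y∈

toA-map-preserves : ∀ n X {l} → block n X l → block n bA (toA-map X l)
toA-map-preserves n bA a = a
toA-map-preserves n bB (i , 1≤i , i≤n , y≡1+i , x∈ , z∈ , w∈) =
  i , 1≤i , i≤n , cong (_- + 1) y≡1+i , x∈ , w∈ , z∈
toA-map-preserves n bC (i , 1≤i , i≤n , x≡1+i , y∈ , z∈ , w∈) =
  i , 1≤i , i≤n , cong (_- + 1) x≡1+i , +-monoˡ-∈[] (- + 1) y∈ , z∈ , w∈
toA-map-preserves n bD (i , 1≤i , i≤n , w≡i , x∈ , y∈ , z∈) =
  i , 1≤i , i≤n , w≡i , x∈ ,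
  subst (λ hi → _ ∈[ + 1 , hi ]) (1+[v-1]≡v (+ i)) (+-monoʳ-∈[] (+ 1) z∈) , y∈

A≅block : ∀ n X → block n bA ≅ block n X
A≅block n X =
  fromA X ,
  mapsOnto-intro (fromA X) (fromA-map X) (toA-map X) (apply-fromA X) (fromA-map∘toA-map≗id X)
                 (fromA-map-preserves n X) (toA-map-preserves n X)

theorem4 : (n : ℕ) → 2 ≤ n → (X Y : Blk) →
    Σ Motion (λ m → MapsOnto m (block n X) (block n Y))
theorem4 n _ X Y = ≅-trans (≅-sym (A≅block n X)) (A≅block n Y)
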